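{- There is a constant $C>1$ such that for all sufficiently large integers $h$, there is a symmetric $2h\times 2h$ matrix $A\in\{0,1\}^{2h\times 2h}$ with $\mathrm{him}(A)\le 10\log_2 h$ and $\mathrm{mimsup}(A)\ge\sqrt h$.
   Context: For a $0/1$ matrix $M$, a submatrix after permutation is obtained by selecting a sequence of distinct row indices and a sequence of distinct column indices (in any order). $\mathrm{mim}(M)$ is the largest $r$ such that $M$ has the $r\times r$ identity matrix as a submatrix after permutation. $\mathrm{him}(M)$ is the largest $r$ such that $M$ has an $r\times r$ triangular matrix with ones on the diagonal as a submatrix after permutation (triangular: all entries below, or all entries above, the diagonal are $0$). $\mathrm{mimsup}(M)=\limsup_{k\to\infty}\mathrm{mim}(M^{\otimes k})^{1/k}$, where $M^{\otimes k}$ is the $k$-fold Kronecker power. -}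

module Defs where

open import Data.Nat using (ℕ; zero; suc; _*_; _^_; _<_)
open import Data.Fin using (Fin; zero; remQuot; toℕ)
open import Data.Bool using (Bool; true; false; _∧_)
open import Data.Product using (Σ; _×_; _,_; ∃-syntax)
open import Data.Sum using (_⊎_)
open import Function.Definitions using (Injective)
open import Relation.Binary.PropositionalEquality using (_≡_)
open import Relation.Nullary using (Dec; yes; no)
open import Data.Fin using (_≟_)

-- 0/1 matrices with m rows and n columns (true = 1, false = 0)
Mat : ℕ → ℕ → Set
Mat m n = Fin m → Fin n → Bool

Symmetric : ∀ {n} → Mat n n → Set
Symmetric A = ∀ i j → A i j ≡ A j i

-- Kronecker product; the index of Fin (m * p) decodes (via remQuot) as the pair (i , k)
-- with i the block index and k the index inside the block.
_⊗_ : ∀ {m n p q} → Mat m n → Mat p q → Mat (m * p) (n * q)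
_⊗_ {m} {n} {p} {q} A B x y with remQuot p x | remQuot q y
... | i , k | j , l = A i j ∧ B k l

kpow : ∀ {n} → Mat n n → (k : ℕ) → Mat (n ^ k) (n ^ k)
kpow A zero    = λ _ _ → true
kpow A (suc k) = A ⊗ kpow A k

Id : (r : ℕ) → Mat r r
Id r i j with i ≟ j
... | yes _ = true
... | no  _ = false

SubmatrixPerm : ∀ {m n r s} → Mat r s → Mat m n → Set
SubmatrixPerm {m} {n} {r} {s} P M =
  Σ (Fin r → Fin m) λ f → Σ (Fin s → Fin n) λ g →
    Injective _≡_ _≡_ f × Injective _≡_ _≡_ g × (∀ i j → M (f i) (g j) ≡ P i j)

Triangular : ∀ {r} → Mat r r → Set
Triangular {r} T =
  (∀ i → T i i ≡ true) ×
  ((∀ (i j : Fin r) → toℕ j < toℕ i → T i j ≡ false) ⊎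
   (∀ (i j : Fin r) → toℕ i < toℕ j → T i j ≡ false))

MimAtLeast : ∀ {m n} → Mat m n → ℕ → Set
MimAtLeast M r = SubmatrixPerm (Id r) M

HasTriangular : ∀ {m n} → Mat m n → ℕ → Set
HasTriangular M r = Σ (Mat r r) λ T → Triangular T × SubmatrixPerm T M

-- him(M) ≤ 10 log₂ h, i.e. every such r satisfies r ≤ 10 log₂ h, i.e. 2^r ≤ h^10
HimLeTenLog2 : ∀ {m n} → Mat m n → ℕ → Set
HimLeTenLog2 M h = ∀ r → HasTriangular M r → 2 ^ r ≤' h ^ 10
  where
  open import Data.Nat using () renaming (_≤_ to _≤'_)

-- mimsup(M) ≥ √h, with mimsup(M) = limsup_k mim(M^{⊗k})^{1/k}.
-- Unfolded: for every nonnegative rational a/b (b > 0) with (a/b)² < h and every N,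
-- there is k ≥ N with mim(M^{⊗k}) ≥ (a/b)^k, i.e. some r with a^k ≤ r * b^k.
MimsupGeSqrt : ∀ {n} → Mat n n → ℕ → Set
MimsupGeSqrt A h =
  ∀ (a b : ℕ) → 0 < b → a * a < h * (b * b) →
  ∀ (N : ℕ) → ∃[ k ] (N ≤' k × ∃[ r ] (a ^ k ≤' r * b ^ k × MimAtLeast (kpow A k) r))
  where
  open import Data.Nat using () renaming (_≤_ to _≤'_)

-- Let A = [[0 , B] , [Bᵀ , 0]] for a tournament B on h vertices, i.e. B s t ∧ B t s = δ s t.
-- In A ⊗ A the rows (top s , bottom s) and the columns (bottom s , top s) meet in
-- B s t ∧ B t s = δ s t, an h × h identity; Kronecker products of identities are identities,
-- so mim (A^⊗2k) ≥ h^k and mimsup A ≥ √h.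
-- A unitriangular r × r submatrix of A has at least half of its rows on one side of the
-- bipartition, and by the symmetry of A we may take it to be the top side. This gives pairs
-- (sᵢ , tᵢ) with B sᵢ tⱼ = 0 for i < j. A fixed list of R such pairs is realised by at most a
-- 2^-(R(R-1)/2) fraction of all tournaments and there are (h²)^R lists, so for R = 4⌈log₂ h⌉ + 2
-- some tournament realises none. Then r ≤ 2R - 2, and 2^r ≤ h^10 once h ≥ 64.

module Submission where

open import Defs
open import Data.Nat using (ℕ; zero; suc; _+_; _*_; _^_; _≤_; _<_; z≤n; s≤s)
import Data.Nat.Properties as ℕ
open import Data.Nat.Solver using (module +-*-Solver)
open import Data.Fin using (Fin; zero; suc; toℕ; combine; remQuot; cast; _≟_)
open import Data.Fin.Properties
  using (combine-injective; combine-surjective; remQuot-combine; combine-remQuot; toℕ-combine; toℕ-cast; toℕ-injective;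
         <-cmp; <-irrefl; <-asym; <⇒≢)
open import Data.Bool using (Bool; true; false; _∧_; _∨_; not; if_then_else_)
open import Data.Bool.Properties
  using (∧-assoc; ∨-zeroʳ; ∧-inverseʳ; not-involutive; not-injective) renaming (_≟_ to _≟ᵇ_)
open import Data.Vec using (Vec; []; _∷_; lookup; updateAt)
open import Data.Vec.Properties using (lookup∘updateAt′)
open import Data.List using (List; []; _∷_; length; _++_)
import Data.List as List
open import Data.List.Properties
  using (length-++; length-map; length-tabulate; length-take; length-reverse; unfold-reverse)
open import Data.List.Relation.Unary.All using (All; []; _∷_)
import Data.List.Relation.Unary.All as All
import Data.List.Relation.Unary.All.Properties as All
open import Data.List.Relation.Unary.AllPairs using (AllPairs; []; _∷_; allPairs?)
import Data.List.Relation.Unary.AllPairs as AllPairs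
import Data.List.Relation.Unary.AllPairs.Properties as AllPairs
open import Data.Product using (Σ; _×_; _,_; proj₁; proj₂; ∃-syntax)
import Data.Product as Product
open import Data.Sum using (inj₁; inj₂)
open import Data.Rational using (ℚ; 1ℚ) renaming (_<_ to _<ℚ_; _+_ to _+ℚ_)
open import Data.Rational.Properties using () renaming (_<?_ to _<ℚ?_)
open import Function using (_∘_; _on_; id; flip)
open import Function.Definitions using (Injective)
open import Relation.Binary.PropositionalEquality
open import Relation.Binary.Definitions using (tri<; tri≈; tri>)
open import Relation.Nullary using (Dec; yes; no; does; ¬_; ¬?; contradiction)
open import Relation.Nullary.Decidable using (dec-true; toWitness)
open import Relation.Unary using (Decidable)
open import Relation.Unary.Properties using (∁?)

-- Kronecker products and induced matchings

Id-refl : ∀ {r} (i : Fin r) → Id r i i ≡ true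
Id-refl i with i ≟ i
... | yes _ = refl
... | no i≢i = contradiction refl i≢i

Id-≢ : ∀ {r} {i j : Fin r} → i ≢ j → Id r i j ≡ false
Id-≢ {i = i} {j} i≢j with i ≟ j
... | yes i≡j = contradiction i≡j i≢j
... | no _ = refl

⊗-combine : ∀ {m n p q} (M : Mat m n) (N : Mat p q) i k j l →
            (M ⊗ N) (combine i k) (combine j l) ≡ (M i j ∧ N k l)
⊗-combine {m} {n} {p} {q} M N i k j l =
  cong₂ (λ x y → M (proj₁ x) (proj₁ y) ∧ N (proj₂ x) (proj₂ y))
        (remQuot-combine {m} {p} i k) (remQuot-combine {n} {q} j l)

Id-combine : ∀ {r s} (i j : Fin r) (k l : Fin s) → Id (r * s) (combine i k) (combine j l) ≡ (Id r i j ∧ Id s k l)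
Id-combine {r} {s} i j k l = by-cases (i ≟ j) (k ≟ l)
  where
  -- A plain `with i ≟ j` would also abstract the occurrence of i ≟ j hidden inside Id r i j.
  by-cases : Dec (i ≡ j) → Dec (k ≡ l) → Id (r * s) (combine i k) (combine j l) ≡ (Id r i j ∧ Id s k l)
  by-cases (no i≢j)   _          = trans (Id-≢ (i≢j ∘ proj₁ ∘ combine-injective i k j l))
                                         (sym (cong (_∧ Id s k l) (Id-≢ i≢j)))
  by-cases (yes refl) (no k≢l)   = trans (Id-≢ (k≢l ∘ proj₂ ∘ combine-injective i k i l))
                                         (sym (cong₂ _∧_ (Id-refl i) (Id-≢ k≢l)))
  by-cases (yes refl) (yes refl) = trans (Id-refl (combine i k)) (sym (cong₂ _∧_ (Id-refl i) (Id-refl k)))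

Id-⊗ : ∀ r s (x y : Fin (r * s)) → (Id r ⊗ Id s) x y ≡ Id (r * s) x y
Id-⊗ r s x y with combine-surjective {r} {s} x | combine-surjective {r} {s} y
... | i , k , refl | j , l , refl = trans (⊗-combine (Id r) (Id s) i k j l) (sym (Id-combine i j k l))

_⊗ᶠ_ : ∀ {r s m p} → (Fin r → Fin m) → (Fin s → Fin p) → Fin (r * s) → Fin (m * p)
_⊗ᶠ_ {r} {s} f g x = combine (f (proj₁ (remQuot {r} s x))) (g (proj₂ (remQuot {r} s x)))

⊗ᶠ-combine : ∀ {r s m p} (f : Fin r → Fin m) (g : Fin s → Fin p) i k →
             (f ⊗ᶠ g) (combine i k) ≡ combine (f i) (g k)
⊗ᶠ-combine {r} {s} f g i k =
  cong (λ x → combine (f (proj₁ x)) (g (proj₂ x))) (remQuot-combine {r} {s} i k)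

⊗ᶠ-injective : ∀ {r s m p} {f : Fin r → Fin m} {g : Fin s → Fin p} →
               Injective _≡_ _≡_ f → Injective _≡_ _≡_ g → Injective _≡_ _≡_ (f ⊗ᶠ g)
⊗ᶠ-injective {r} {s} {f = f} {g} f-inj g-inj {x} {y} fx≡fy
  with combine-surjective {r} {s} x | combine-surjective {r} {s} y
... | i , k , refl | j , l , refl
  with combine-injective (f i) (g k) (f j) (g l)
         (trans (sym (⊗ᶠ-combine f g i k)) (trans fx≡fy (⊗ᶠ-combine f g j l)))
... | fi≡fj , gk≡gl = cong₂ combine (f-inj fi≡fj) (g-inj gk≡gl)

⊗-submatrix : ∀ {m n p q r s r′ s′} {M : Mat m n} {N : Mat p q} {P : Mat r s} {Q : Mat r′ s′} →
              SubmatrixPerm P M → SubmatrixPerm Q N → SubmatrixPerm (P ⊗ Q) (M ⊗ N)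
⊗-submatrix {r = r} {s} {r′} {s′} {M} {N} {P} {Q}
            (f , g , f-inj , g-inj , M≡P) (f′ , g′ , f′-inj , g′-inj , N≡Q) =
  f ⊗ᶠ f′ , g ⊗ᶠ g′ , ⊗ᶠ-injective f-inj f′-inj , ⊗ᶠ-injective g-inj g′-inj , entries
  where
  entries : ∀ x y → (M ⊗ N) ((f ⊗ᶠ f′) x) ((g ⊗ᶠ g′) y) ≡ (P ⊗ Q) x y
  entries x y with combine-surjective {r} {r′} x | combine-surjective {s} {s′} y
  ... | i , k , refl | j , l , refl = begin
    (M ⊗ N) ((f ⊗ᶠ f′) (combine i k)) ((g ⊗ᶠ g′) (combine j l))
      ≡⟨ cong₂ (M ⊗ N) (⊗ᶠ-combine f f′ i k) (⊗ᶠ-combine g g′ j l) ⟩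
    (M ⊗ N) (combine (f i) (f′ k)) (combine (g j) (g′ l))
      ≡⟨ ⊗-combine M N (f i) (f′ k) (g j) (g′ l) ⟩
    M (f i) (g j) ∧ N (f′ k) (g′ l)
      ≡⟨ cong₂ _∧_ (M≡P i j) (N≡Q k l) ⟩
    P i j ∧ Q k l
      ≡⟨ ⊗-combine P Q i k j l ⟨
    (P ⊗ Q) (combine i k) (combine j l) ∎
    where open ≡-Reasoning

submatrix-cong : ∀ {m n r s} {M : Mat m n} {P Q : Mat r s} →
                 (∀ i j → P i j ≡ Q i j) → SubmatrixPerm P M → SubmatrixPerm Q M
submatrix-cong P≡Q (f , g , f-inj , g-inj , M≡P) = f , g , f-inj , g-inj , λ i j → trans (M≡P i j) (P≡Q i j)

mim-⊗ : ∀ {m n p q r s} {M : Mat m n} {N : Mat p q} →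
        MimAtLeast M r → MimAtLeast N s → MimAtLeast (M ⊗ N) (r * s)
mim-⊗ {r = r} {s} {M} {N} mimM mimN = submatrix-cong {M = M ⊗ N} (Id-⊗ r s) (⊗-submatrix {M = M} {N} mimM mimN)

reassoc : ∀ m n p → Fin ((m * n) * p) → Fin (m * (n * p))
reassoc m n p = cast (ℕ.*-assoc m n p)

reassoc-injective : ∀ {m n p} → Injective _≡_ _≡_ (reassoc m n p)
reassoc-injective {x = x} {y} e =
  toℕ-injective (trans (sym (toℕ-cast _ x)) (trans (cong toℕ e) (toℕ-cast _ y)))

reassoc-combine : ∀ {m n p} (i : Fin m) (j : Fin n) (k : Fin p) →
                  reassoc m n p (combine (combine i j) k) ≡ combine i (combine j k)
reassoc-combine {m} {n} {p} i j k = toℕ-injective (begin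
  toℕ (reassoc m n p (combine (combine i j) k)) ≡⟨ toℕ-cast _ _ ⟩
  toℕ (combine (combine i j) k)             ≡⟨ toℕ-combine (combine i j) k ⟩
  p * toℕ (combine i j) + toℕ k             ≡⟨ cong (λ z → p * z + toℕ k) (toℕ-combine i j) ⟩
  p * (n * toℕ i + toℕ j) + toℕ k          ≡⟨ solve 5 (λ n p a b c → p :* (n :* a :+ b) :+ c
                                                          := (n :* p) :* a :+ (p :* b :+ c))
                                                refl n p (toℕ i) (toℕ j) (toℕ k) ⟩
  (n * p) * toℕ i + (p * toℕ j + toℕ k)     ≡⟨ cong ((n * p) * toℕ i +_) (toℕ-combine j k) ⟨
  (n * p) * toℕ i + toℕ (combine j k)       ≡⟨ toℕ-combine i (combine j k) ⟨
  toℕ (combine i (combine j k)) ∎)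
  where
  open ≡-Reasoning
  open +-*-Solver

⊗-reassoc : ∀ {m m′ n n′ p p′} (M : Mat m m′) (N : Mat n n′) (X : Mat p p′) x y →
            (M ⊗ (N ⊗ X)) (reassoc m n p x) (reassoc m′ n′ p′ y) ≡ ((M ⊗ N) ⊗ X) x y
⊗-reassoc {m} {m′} {n} {n′} {p} {p′} M N X x y
  with combine-surjective {m * n} {p} x | combine-surjective {m′ * n′} {p′} y
... | ij , k , refl | ij′ , k′ , refl
  with combine-surjective {m} {n} ij | combine-surjective {m′} {n′} ij′
... | i , j , refl | i′ , j′ , refl = begin
  (M ⊗ (N ⊗ X)) (reassoc m n p (combine (combine i j) k)) (reassoc m′ n′ p′ (combine (combine i′ j′) k′))
    ≡⟨ cong₂ (M ⊗ (N ⊗ X)) (reassoc-combine i j k) (reassoc-combine i′ j′ k′) ⟩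
  (M ⊗ (N ⊗ X)) (combine i (combine j k)) (combine i′ (combine j′ k′))
    ≡⟨ ⊗-combine M (N ⊗ X) i (combine j k) i′ (combine j′ k′) ⟩
  M i i′ ∧ (N ⊗ X) (combine j k) (combine j′ k′)
    ≡⟨ cong (M i i′ ∧_) (⊗-combine N X j k j′ k′) ⟩
  M i i′ ∧ (N j j′ ∧ X k k′)
    ≡⟨ ∧-assoc (M i i′) (N j j′) (X k k′) ⟨
  (M i i′ ∧ N j j′) ∧ X k k′
    ≡⟨ cong (_∧ X k k′) (⊗-combine M N i j i′ j′) ⟨
  (M ⊗ N) (combine i j) (combine i′ j′) ∧ X k k′
    ≡⟨ ⊗-combine (M ⊗ N) X (combine i j) k (combine i′ j′) k′ ⟨
  ((M ⊗ N) ⊗ X) (combine (combine i j) k) (combine (combine i′ j′) k′) ∎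
  where open ≡-Reasoning

submatrix-reassoc : ∀ {m m′ n n′ p p′ r s} {M : Mat m m′} {N : Mat n n′} {X : Mat p p′} {P : Mat r s} →
                    SubmatrixPerm P ((M ⊗ N) ⊗ X) → SubmatrixPerm P (M ⊗ (N ⊗ X))
submatrix-reassoc {m} {m′} {n} {n′} {p} {p′} {M = M} {N} {X} (f , g , f-inj , g-inj , entries) =
  reassoc m n p ∘ f , reassoc m′ n′ p′ ∘ g ,
  f-inj ∘ reassoc-injective {m} {n} {p} , g-inj ∘ reassoc-injective {m′} {n′} {p′} ,
  λ i j → trans (⊗-reassoc M N X (f i) (g j)) (entries i j)

mim-kpow-even : ∀ {n} (A : Mat n n) {r} → MimAtLeast (A ⊗ A) r → ∀ k → MimAtLeast (kpow A (2 * k)) (r ^ k)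
mim-kpow-even A mimAA zero = id , id , id , id , λ { zero zero → refl }
mim-kpow-even A {r} mimAA (suc k) =
  subst (λ l → MimAtLeast (kpow A l) (r ^ suc k)) (sym (ℕ.*-suc 2 k))
        (submatrix-reassoc {M = A} {A} {kpow A (2 * k)}
          (mim-⊗ {M = A ⊗ A} {kpow A (2 * k)} mimAA (mim-kpow-even A mimAA k)))

^-distribʳ-* : ∀ m n o → (m * n) ^ o ≡ m ^ o * n ^ o
^-distribʳ-* m n zero = refl
^-distribʳ-* m n (suc o) = trans (cong ((m * n) *_) (^-distribʳ-* m n o))
                                 (solve 4 (λ m n a b → (m :* n) :* (a :* b) := (m :* a) :* (n :* b))
                                        refl m n (m ^ o) (n ^ o))
  where open +-*-Solver

square-≤⇒even-power-≤ : ∀ {a b h} k → a * a ≤ h * (b * b) → a ^ (2 * k) ≤ h ^ k * b ^ (2 * k)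
square-≤⇒even-power-≤ {a} {b} {h} k a²≤hb² = begin
  a ^ (2 * k)        ≡⟨ ℕ.^-*-assoc a 2 k ⟨
  (a ^ 2) ^ k        ≤⟨ ℕ.^-monoˡ-≤ k (subst₂ _≤_ (square a) (cong (h *_) (square b)) a²≤hb²) ⟩
  (h * b ^ 2) ^ k    ≡⟨ ^-distribʳ-* h (b ^ 2) k ⟩
  h ^ k * (b ^ 2) ^ k ≡⟨ cong (h ^ k *_) (ℕ.^-*-assoc b 2 k) ⟩
  h ^ k * b ^ (2 * k) ∎
  where
  open ℕ.≤-Reasoning
  square : ∀ x → x * x ≡ x ^ 2
  square x = cong (x *_) (sym (ℕ.*-identityʳ x))

mimsup-≥-sqrt : ∀ {n h} (A : Mat n n) → MimAtLeast (A ⊗ A) h → MimsupGeSqrt A h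
mimsup-≥-sqrt {h = h} A mimAA a b _ a²<hb² k =
  2 * k , ℕ.m≤n*m k 2 , h ^ k , square-≤⇒even-power-≤ k (ℕ.<⇒≤ a²<hb²) , mim-kpow-even A mimAA k

-- The bipartite matrix of a tournament

bipartiteBlock : ∀ {h} → Mat h h → Fin 2 → Fin 2 → Mat h h
bipartiteBlock B zero       (suc zero) s t = B s t
bipartiteBlock B (suc zero) zero       s t = B t s
bipartiteBlock B _          _          s t = false

side : ∀ {h} → Fin (2 * h) → Fin 2
side {h} x = proj₁ (remQuot {2} h x)

index : ∀ {h} → Fin (2 * h) → Fin h
index {h} x = proj₂ (remQuot {2} h x)

bipartite : ∀ {h} → Mat h h → Mat (2 * h) (2 * h)
bipartite {h} B x y = bipartiteBlock B (side {h} x) (side {h} y) (index x) (index y)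

bipartite-combine : ∀ {h} (B : Mat h h) a s b t → bipartite B (combine a s) (combine b t) ≡ bipartiteBlock B a b s t
bipartite-combine {h} B a s b t =
  cong₂ (λ x y → bipartiteBlock B (proj₁ x) (proj₁ y) (proj₂ x) (proj₂ y))
        (remQuot-combine {2} {h} a s) (remQuot-combine {2} {h} b t)

bipartite-symmetric : ∀ {h} (B : Mat h h) → Symmetric (bipartite B)
bipartite-symmetric {h} B x y = block-symmetric (side {h} x) (side {h} y) (index x) (index y)
  where
  block-symmetric : ∀ a b s t → bipartiteBlock B a b s t ≡ bipartiteBlock B b a t s
  block-symmetric zero       zero       s t = refl
  block-symmetric zero       (suc zero) s t = refl
  block-symmetric (suc zero) zero       s t = refl
  block-symmetric (suc zero) (suc zero) s t = refl

side-index-injective : ∀ {h} {x x′ : Fin (2 * h)} →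
                       side {h} x ≡ side {h} x′ → index {h} x ≡ index {h} x′ → x ≡ x′
side-index-injective {h} {x} {x′} same-side same-index =
  trans (sym (combine-remQuot {2} h x)) (trans (cong₂ combine same-side same-index) (combine-remQuot {2} h x′))

bipartite-top-row : ∀ {h} (B : Mat h h) {x y : Fin (2 * h)} →
                    side {h} x ≡ zero → bipartite B x y ≡ true → side {h} y ≡ suc zero
bipartite-top-row {h} B {x} {y} x-top Axy =
  column-side (side {h} y) (subst (λ a → bipartiteBlock B a (side {h} y) (index x) (index y) ≡ true) x-top Axy)
  where
  column-side : ∀ b → bipartiteBlock B zero b (index x) (index y) ≡ true → b ≡ suc zero
  column-side (suc zero) _ = refl

bipartite-bottom-row : ∀ {h} (B : Mat h h) {x y : Fin (2 * h)} →
                       side {h} x ≢ zero → bipartite B x y ≡ true → side {h} y ≡ zero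
bipartite-bottom-row {h} B {x} {y} x-bottom Axy = column-side (side {h} x) (side {h} y) x-bottom Axy
  where
  column-side : ∀ a b → a ≢ zero → bipartiteBlock B a b (index x) (index y) ≡ true → b ≡ zero
  column-side zero       _    a≢0 _ = contradiction refl a≢0
  column-side (suc zero) zero _   _ = refl

bipartite-top-bottom : ∀ {h} (B : Mat h h) {x y : Fin (2 * h)} →
                       side {h} x ≡ zero → side {h} y ≡ suc zero → bipartite B x y ≡ B (index x) (index y)
bipartite-top-bottom {h} B {x} {y} x-top y-bottom =
  cong₂ (λ a b → bipartiteBlock B a b (index x) (index y)) x-top y-bottom

TopRow : ∀ {h} → Fin (2 * h) × Fin (2 * h) → Set
TopRow {h} (x , _) = side {h} x ≡ zero

top-row? : ∀ {h} → Decidable (TopRow {h})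
top-row? {h} (x , _) = side {h} x ≟ zero

ReflexiveAntisymmetric : ∀ {h} → Mat h h → Set
ReflexiveAntisymmetric {h} B = ∀ s t → (B s t ∧ B t s) ≡ Id h s t

mim-bipartite-⊗ : ∀ {h} {B : Mat h h} → ReflexiveAntisymmetric B → MimAtLeast (bipartite B ⊗ bipartite B) h
mim-bipartite-⊗ {h} {B} B-refl-antisym = row , column , row-injective , column-injective , entries
  where
  top bottom : Fin h → Fin (2 * h)
  top = combine {2} zero
  bottom = combine {2} (suc zero)
  row column : Fin h → Fin (2 * h * (2 * h))
  row s = combine (top s) (bottom s)
  column s = combine (bottom s) (top s)
  top-injective : Injective _≡_ _≡_ top
  top-injective {s} {t} = proj₂ ∘ combine-injective {2} zero s zero t
  row-injective : Injective _≡_ _≡_ row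
  row-injective {s} {t} = top-injective ∘ proj₁ ∘ combine-injective (top s) (bottom s) (top t) (bottom t)
  column-injective : Injective _≡_ _≡_ column
  column-injective {s} {t} = top-injective ∘ proj₂ ∘ combine-injective (bottom s) (top s) (bottom t) (top t)
  entries : ∀ s t → (bipartite B ⊗ bipartite B) (row s) (column t) ≡ Id h s t
  entries s t = begin
    (bipartite B ⊗ bipartite B) (row s) (column t)
      ≡⟨ ⊗-combine (bipartite B) (bipartite B) (top s) (bottom s) (bottom t) (top t) ⟩
    bipartite B (top s) (bottom t) ∧ bipartite B (bottom s) (top t)
      ≡⟨ cong₂ _∧_ (bipartite-combine B zero s (suc zero) t) (bipartite-combine B (suc zero) s zero t) ⟩
    B s t ∧ B t s
      ≡⟨ B-refl-antisym s t ⟩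
    Id h s t ∎
    where open ≡-Reasoning

-- Counting Boolean assignments

count : ∀ n → (Vec Bool n → Bool) → ℕ
count zero    P = if P [] then 1 else 0
count (suc n) P = count n (P ∘ (true ∷_)) + count n (P ∘ (false ∷_))

count-cong : ∀ n {P Q : Vec Bool n → Bool} → (∀ v → P v ≡ Q v) → count n P ≡ count n Q
count-cong zero    P≗Q = cong (λ b → if b then 1 else 0) (P≗Q [])
count-cong (suc n) P≗Q = cong₂ _+_ (count-cong n (P≗Q ∘ (true ∷_))) (count-cong n (P≗Q ∘ (false ∷_)))

count-false : ∀ n {P : Vec Bool n → Bool} → (∀ v → P v ≡ false) → count n P ≡ 0
count-false zero    P≡false = cong (λ b → if b then 1 else 0) (P≡false [])
count-false (suc n) P≡false =
  cong₂ _+_ (count-false n (P≡false ∘ (true ∷_))) (count-false n (P≡false ∘ (false ∷_)))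

count-true : ∀ n → count n (λ _ → true) ≡ 2 ^ n
count-true zero    = refl
count-true (suc n) = cong₂ _+_ (count-true n) (trans (count-true n) (sym (ℕ.+-identityʳ (2 ^ n))))

count-∨ : ∀ n (P Q : Vec Bool n → Bool) → count n (λ v → P v ∨ Q v) ≤ count n P + count n Q
count-∨ zero P Q with P [] | Q []
... | true  | true  = s≤s z≤n
... | true  | false = ℕ.≤-refl
... | false | _     = ℕ.≤-refl
count-∨ (suc n) P Q = begin
  count n (λ v → P (true ∷ v) ∨ Q (true ∷ v)) + count n (λ v → P (false ∷ v) ∨ Q (false ∷ v))
    ≤⟨ ℕ.+-mono-≤ (count-∨ n _ _) (count-∨ n _ _) ⟩
  (P₁ + Q₁) + (P₀ + Q₀)
    ≡⟨ solve 4 (λ a b c d → (a :+ b) :+ (c :+ d) := (a :+ c) :+ (b :+ d)) refl P₁ Q₁ P₀ Q₀ ⟩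
  (P₁ + P₀) + (Q₁ + Q₀) ∎
  where
  open ℕ.≤-Reasoning
  open +-*-Solver
  P₁ = count n (P ∘ (true ∷_))
  P₀ = count n (P ∘ (false ∷_))
  Q₁ = count n (Q ∘ (true ∷_))
  Q₀ = count n (Q ∘ (false ∷_))

count<2^n⇒∃false : ∀ n (P : Vec Bool n → Bool) → count n P < 2 ^ n → ∃[ v ] P v ≡ false
count<2^n⇒∃false zero P count<1 with P [] in P[]
... | false = [] , P[]
... | true  = contradiction count<1 (ℕ.<-irrefl refl)
count<2^n⇒∃false (suc n) P count< with count n (P ∘ (true ∷_)) ℕ.<? 2 ^ n
... | yes count₁< = Product.map (true ∷_) id (count<2^n⇒∃false n (P ∘ (true ∷_)) count₁<)
... | no  count₁≮ = Product.map (false ∷_) id (count<2^n⇒∃false n (P ∘ (false ∷_)) count₀<)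
  where
  count₀< : count n (P ∘ (false ∷_)) < 2 ^ n
  count₀< = ℕ.+-cancelˡ-< (2 ^ n) _ _ (begin-strict
    2 ^ n + count n (P ∘ (false ∷_))                      ≤⟨ ℕ.+-monoˡ-≤ _ (ℕ.≮⇒≥ count₁≮) ⟩
    count n (P ∘ (true ∷_)) + count n (P ∘ (false ∷_))    <⟨ count< ⟩
    2 ^ n + (2 ^ n + 0)                                   ≡⟨ cong (2 ^ n +_) (ℕ.+-identityʳ (2 ^ n)) ⟩
    2 ^ n + 2 ^ n                                         ∎)
    where open ℕ.≤-Reasoning

Literal : ℕ → Set
Literal n = Fin n × Bool

_⊨_ : ∀ {n} → Vec Bool n → Literal n → Bool
v ⊨ (p , b) = does (lookup v p ≟ᵇ b)

_⊨*_ : ∀ {n} → Vec Bool n → List (Literal n) → Bool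
v ⊨* []      = true
v ⊨* (l ∷ L) = v ⊨ l ∧ v ⊨* L

⊨-intro : ∀ {n} {v : Vec Bool n} {p b} → lookup v p ≡ b → v ⊨ (p , b) ≡ true
⊨-intro {v = v} {p} {b} = dec-true (lookup v p ≟ᵇ b)

⊨-sound : ∀ {n} {v : Vec Bool n} {p b} → v ⊨ (p , b) ≡ true → lookup v p ≡ b
⊨-sound {v = v} {p} {b} with lookup v p ≟ᵇ b
... | yes vp≡b = λ _ → vp≡b
... | no  _    = λ ()

⊨*-intro : ∀ {n} {v : Vec Bool n} {L} → All (λ l → v ⊨ l ≡ true) L → v ⊨* L ≡ true
⊨*-intro []             = refl
⊨*-intro (v⊨l ∷ v⊨*L) = cong₂ _∧_ v⊨l (⊨*-intro v⊨*L)

Independent : ∀ {n} → Fin n → (Vec Bool n → Bool) → Set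
Independent p Q = ∀ v → Q (updateAt v p not) ≡ Q v

⊨*-independent : ∀ {n} (p : Fin n) (L : List (Literal n)) → All (λ l → proj₁ l ≢ p) L → Independent p (_⊨* L)
⊨*-independent p []            []           v = refl
⊨*-independent p ((q , b) ∷ L) (q≢p ∷ L∌p) v =
  cong₂ _∧_ (cong (λ x → does (x ≟ᵇ b)) (lookup∘updateAt′ q p q≢p v)) (⊨*-independent p L L∌p v)

count-literal-∧ : ∀ n (p : Fin n) b (Q : Vec Bool n → Bool) → Independent p Q →
                  2 * count n (λ v → v ⊨ (p , b) ∧ Q v) ≡ count n Q
count-literal-∧ (suc n) zero true Q Q-indep = begin
  2 * (count₁ + count n (λ _ → false))  ≡⟨ cong (λ c → 2 * (count₁ + c)) (count-false n (λ _ → refl)) ⟩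
  2 * (count₁ + 0)                      ≡⟨ cong (2 *_) (ℕ.+-identityʳ count₁) ⟩
  2 * count₁                            ≡⟨ cong (count₁ +_) (trans (ℕ.+-identityʳ count₁) count₁≡count₀) ⟩
  count₁ + count₀                       ∎
  where
  open ≡-Reasoning
  count₁ = count n (Q ∘ (true ∷_))
  count₀ = count n (Q ∘ (false ∷_))
  count₁≡count₀ : count₁ ≡ count₀
  count₁≡count₀ = count-cong n (Q-indep ∘ (false ∷_))
count-literal-∧ (suc n) zero false Q Q-indep = begin
  2 * (count n (λ _ → false) + count₀)  ≡⟨ cong (λ c → 2 * (c + count₀)) (count-false n (λ _ → refl)) ⟩
  2 * count₀                            ≡⟨ cong₂ _+_ (sym count₁≡count₀) (ℕ.+-identityʳ count₀) ⟩
  count₁ + count₀                       ∎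
  where
  open ≡-Reasoning
  count₁ = count n (Q ∘ (true ∷_))
  count₀ = count n (Q ∘ (false ∷_))
  count₁≡count₀ : count₁ ≡ count₀
  count₁≡count₀ = count-cong n (Q-indep ∘ (false ∷_))
count-literal-∧ (suc n) (suc p) b Q Q-indep =
  trans (ℕ.*-distribˡ-+ 2 (count n (λ v → v ⊨ (p , b) ∧ Q (true ∷ v))) _)
        (cong₂ _+_ (count-literal-∧ n p b (Q ∘ (true ∷_)) (Q-indep ∘ (true ∷_)))
                   (count-literal-∧ n p b (Q ∘ (false ∷_)) (Q-indep ∘ (false ∷_))))

count-⊨* : ∀ n (L : List (Literal n)) → AllPairs (_≢_ on proj₁) L → 2 ^ length L * count n (_⊨* L) ≡ 2 ^ n
count-⊨* n [] [] = trans (ℕ.+-identityʳ (count n (λ _ → true))) (count-true n)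
count-⊨* n ((p , b) ∷ L) (p∉L ∷ L-distinct) = begin
  2 ^ suc (length L) * count n (λ v → v ⊨ (p , b) ∧ v ⊨* L)
    ≡⟨ solve 2 (λ K X → (con 2 :* K) :* X := K :* (con 2 :* X)) refl (2 ^ length L) _ ⟩
  2 ^ length L * (2 * count n (λ v → v ⊨ (p , b) ∧ v ⊨* L))
    ≡⟨ cong (2 ^ length L *_) (count-literal-∧ n p b (_⊨* L) (⊨*-independent p L (All.map (_∘ sym) p∉L))) ⟩
  2 ^ length L * count n (_⊨* L)
    ≡⟨ count-⊨* n L L-distinct ⟩
  2 ^ n ∎
  where
  open ≡-Reasoning
  open +-*-Solver

anyᶠ : ∀ {k} → (Fin k → Bool) → Bool
anyᶠ {zero}  P = false
anyᶠ {suc k} P = P zero ∨ anyᶠ (P ∘ suc)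

anyᶠ-intro : ∀ {k} (P : Fin k → Bool) i → P i ≡ true → anyᶠ P ≡ true
anyᶠ-intro P zero    Pi = cong (_∨ anyᶠ (P ∘ suc)) Pi
anyᶠ-intro P (suc i) Pi = trans (cong (P zero ∨_) (anyᶠ-intro (P ∘ suc) i Pi)) (∨-zeroʳ (P zero))

count-anyᶠ : ∀ n k (E : Fin k → Vec Bool n → Bool) {K M} → (∀ i → count n (E i) * K ≤ M) →
             count n (λ v → anyᶠ (λ i → E i v)) * K ≤ k * M
count-anyᶠ n zero    E {K} _ = ℕ.≤-reflexive (cong (_* K) (count-false n (λ _ → refl)))
count-anyᶠ n (suc k) E {K} {M} bound = begin
  count n (λ v → E zero v ∨ anyᶠ (λ i → E (suc i) v)) * K
    ≤⟨ ℕ.*-monoˡ-≤ K (count-∨ n _ _) ⟩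
  (count n (E zero) + count n (λ v → anyᶠ (λ i → E (suc i) v))) * K
    ≡⟨ ℕ.*-distribʳ-+ K (count n (E zero)) _ ⟩
  count n (E zero) * K + count n (λ v → anyᶠ (λ i → E (suc i) v)) * K
    ≤⟨ ℕ.+-mono-≤ (bound zero) (count-anyᶠ n k (E ∘ suc) (bound ∘ suc)) ⟩
  M + k * M ∎
  where open ℕ.≤-Reasoning

anyWord : ∀ {X : Set} {k} → (Fin k → X) → ℕ → (List X → Bool) → Bool
anyWord letter zero    P = P []
anyWord letter (suc r) P = anyᶠ (λ i → anyWord letter r (P ∘ (letter i ∷_)))

anyWord-intro : ∀ {X : Set} {k} (letter : Fin k → X) → (∀ x → ∃[ i ] letter i ≡ x) →
                ∀ r (P : List X → Bool) w → length w ≡ r → P w ≡ true → anyWord letter r P ≡ true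
anyWord-intro letter surjective zero    P []      refl Pw = Pw
anyWord-intro letter surjective (suc r) P (x ∷ w) refl Pw with surjective x
... | i , refl = anyᶠ-intro _ i (anyWord-intro letter surjective r (P ∘ (letter i ∷_)) w refl Pw)

count-anyWord : ∀ {X : Set} {k} (letter : Fin k → X) n r (E : List X → Vec Bool n → Bool) {K M} →
                (∀ w → length w ≡ r → count n (E w) * K ≤ M) →
                count n (λ v → anyWord letter r (λ w → E w v)) * K ≤ k ^ r * M
count-anyWord letter n zero E {M = M} bound = ℕ.≤-trans (bound [] refl) (ℕ.≤-reflexive (sym (ℕ.+-identityʳ M)))
count-anyWord {k = k} letter n (suc r) E {M = M} bound =
  ℕ.≤-trans (count-anyᶠ n k _ λ i → count-anyWord letter n r (E ∘ (letter i ∷_))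
                                       λ w |w|≡r → bound (letter i ∷ w) (cong suc |w|≡r))
            (ℕ.≤-reflexive (sym (ℕ.*-assoc k (k ^ r) M)))

AllPairs-zipWith-All : ∀ {A : Set} {P : A → Set} {R S : A → A → Set} {xs} →
                       (∀ {x y} → P x → P y → R x y → S x y) → All P xs → AllPairs R xs → AllPairs S xs
AllPairs-zipWith-All f []         []         = []
AllPairs-zipWith-All f (px ∷ pxs) (Rx ∷ Rxs) =
  All.zipWith (λ (py , Rxy) → f px py Rxy) (pxs , Rx) ∷ AllPairs-zipWith-All f pxs Rxs

satisfied⇒distinct-positions : ∀ {n} {v : Vec Bool n} {L : List (Literal n)} →
                               All (λ l → v ⊨ l ≡ true) L → AllPairs _≢_ L → AllPairs (_≢_ on proj₁) L
satisfied⇒distinct-positions {v = v} = AllPairs-zipWith-All same-position⇒same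
  where
  same-position⇒same : ∀ {l l′} → v ⊨ l ≡ true → v ⊨ l′ ≡ true → l ≢ l′ → proj₁ l ≢ proj₁ l′
  same-position⇒same {p , b} {p , b′} v⊨l v⊨l′ l≢l′ refl =
    l≢l′ (cong (p ,_) (trans (sym (⊨-sound {v = v} {p} {b} v⊨l)) (⊨-sound {v = v} {p} {b′} v⊨l′)))

-- The guard makes the count bound unconditional; satisfied lists of distinct literals pass it.
satisfiesDistinct : ∀ {n} → List (Literal n) → Vec Bool n → Bool
satisfiesDistinct L v = does (allPairs? (λ l l′ → ¬? (proj₁ l ≟ proj₁ l′)) L) ∧ v ⊨* L

count-satisfiesDistinct : ∀ n (L : List (Literal n)) → count n (satisfiesDistinct L) * 2 ^ length L ≤ 2 ^ n
count-satisfiesDistinct n L = bound (allPairs? (λ l l′ → ¬? (proj₁ l ≟ proj₁ l′)) L)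
  where
  bound : (d : Dec (AllPairs (_≢_ on proj₁) L)) → count n (λ v → does d ∧ v ⊨* L) * 2 ^ length L ≤ 2 ^ n
  bound (yes distinct) = ℕ.≤-reflexive (trans (ℕ.*-comm (count n (_⊨* L)) _) (count-⊨* n L distinct))
  bound (no _)         = ℕ.≤-trans (ℕ.≤-reflexive (cong (_* 2 ^ length L) (count-false n (λ _ → refl)))) z≤n

satisfiesDistinct-intro : ∀ {n} {v : Vec Bool n} {L : List (Literal n)} →
                          All (λ l → v ⊨ l ≡ true) L → AllPairs _≢_ L → satisfiesDistinct L v ≡ true
satisfiesDistinct-intro {v = v} {L} v⊨L L-unique =
  cong₂ _∧_ (dec-true (allPairs? (λ l l′ → ¬? (proj₁ l ≟ proj₁ l′)) L)
                      (satisfied⇒distinct-positions {v = v} v⊨L L-unique))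
            (⊨*-intro v⊨L)

-- Random tournaments

-- AllPairs (ZeroAbove M) ((x₁ , y₁) ∷ …): distinct xᵢ, distinct yᵢ, and M xᵢ yⱼ = 0 for i < j.
ZeroAbove : ∀ {m n} → Mat m n → Fin m × Fin n → Fin m × Fin n → Set
ZeroAbove M (x , y) (x′ , y′) = x ≢ x′ × y ≢ y′ × M x y′ ≡ false

-- For s < t, the bit of c at combine s t orients the edge between s and t.
tournament : ∀ {h} → Vec Bool (h * h) → Mat h h
tournament c s t with <-cmp s t
... | tri< _ _ _ = lookup c (combine s t)
... | tri≈ _ _ _ = true
... | tri> _ _ _ = not (lookup c (combine t s))

tournament-refl : ∀ {h} (c : Vec Bool (h * h)) (s : Fin h) → tournament c s s ≡ true
tournament-refl c s with <-cmp s s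
... | tri< s<s _ _ = contradiction s<s (<-irrefl refl)
... | tri≈ _ _ _   = refl
... | tri> _ _ s<s = contradiction s<s (<-irrefl refl)

tournament-flip : ∀ {h} (c : Vec Bool (h * h)) {s t : Fin h} → s ≢ t → tournament c t s ≡ not (tournament c s t)
tournament-flip c {s} {t} s≢t with <-cmp s t | <-cmp t s
... | tri< _ _ _   | tri> _ _ _   = refl
... | tri> _ _ _   | tri< _ _ _   = sym (not-involutive _)
... | tri≈ _ s≡t _ | _            = contradiction s≡t s≢t
... | _            | tri≈ _ t≡s _ = contradiction (sym t≡s) s≢t
... | tri< s<t _ _ | tri< t<s _ _ = contradiction t<s (<-asym s<t)
... | tri> _ _ t<s | tri> _ _ s<t = contradiction s<t (<-asym t<s)

tournament-reflexiveAntisymmetric : ∀ {h} (c : Vec Bool (h * h)) → ReflexiveAntisymmetric (tournament {h} c)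
tournament-reflexiveAntisymmetric {h} c s t = by-cases (s ≟ t)
  where
  by-cases : Dec (s ≡ t) → (tournament c s t ∧ tournament c t s) ≡ Id h s t
  by-cases (yes refl) = trans (cong (λ b → b ∧ b) (tournament-refl c s)) (sym (Id-refl s))
  by-cases (no s≢t)   = trans (cong (tournament c s t ∧_) (tournament-flip c s≢t))
                              (trans (∧-inverseʳ (tournament c s t)) (sym (Id-≢ s≢t)))

tournament-zero⇒≢ : ∀ {h} (c : Vec Bool (h * h)) {s t : Fin h} → tournament c s t ≡ false → s ≢ t
tournament-zero⇒≢ c {s} Bss≡false refl = contradiction (trans (sym Bss≡false) (tournament-refl c s)) λ ()

zeroLiteral : ∀ {h} → Fin h → Fin h → Literal (h * h)
zeroLiteral s t with <-cmp s t
... | tri< _ _ _ = combine s t , false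
... | tri≈ _ _ _ = combine s t , false
... | tri> _ _ _ = combine t s , true

zeroLiteral-sound : ∀ {h} (c : Vec Bool (h * h)) {s t : Fin h} → tournament c s t ≡ false → c ⊨ zeroLiteral s t ≡ true
zeroLiteral-sound c {s} {t} Bst≡false with <-cmp s t
... | tri< _ _ _ = ⊨-intro {v = c} Bst≡false
... | tri≈ _ _ _ = contradiction Bst≡false λ ()
... | tri> _ _ _ = ⊨-intro {v = c} (not-injective Bst≡false)

zeroLiteral-injective : ∀ {h} {s t s′ t′ : Fin h} → s ≢ t → s′ ≢ t′ →
                        zeroLiteral s t ≡ zeroLiteral s′ t′ → s ≡ s′ × t ≡ t′
zeroLiteral-injective {s = s} {t} {s′} {t′} s≢t s′≢t′ e with <-cmp s t | <-cmp s′ t′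
... | tri≈ _ s≡t _ | _               = contradiction s≡t s≢t
... | _            | tri≈ _ s′≡t′ _  = contradiction s′≡t′ s′≢t′
... | tri< _ _ _   | tri< _ _ _      = combine-injective s t s′ t′ (cong proj₁ e)
... | tri> _ _ _   | tri> _ _ _      = Product.swap (combine-injective t s t′ s′ (cong proj₁ e))
... | tri< _ _ _   | tri> _ _ _      = contradiction (cong proj₂ e) λ ()
... | tri> _ _ _   | tri< _ _ _      = contradiction (cong proj₂ e) λ ()

triangular : ℕ → ℕ
triangular zero    = zero
triangular (suc r) = r + triangular r

zeroLiterals : ∀ {h} → List (Fin h × Fin h) → List (Literal (h * h))
zeroLiterals []             = []
zeroLiterals ((s , _) ∷ ps) = List.map (zeroLiteral s ∘ proj₂) ps ++ zeroLiterals ps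

length-zeroLiterals : ∀ {h} (ps : List (Fin h × Fin h)) → length (zeroLiterals ps) ≡ triangular (length ps)
length-zeroLiterals []             = refl
length-zeroLiterals ((s , _) ∷ ps) =
  trans (length-++ (List.map (zeroLiteral s ∘ proj₂) ps))
        (cong₂ _+_ (length-map (zeroLiteral s ∘ proj₂) ps) (length-zeroLiterals ps))

Separated : ∀ {h} → Fin h × Fin h → Fin h × Fin h → Set
Separated (s , t) (s′ , t′) = s ≢ s′ × t ≢ t′ × s ≢ t′

zeroLiteral-∉-zeroLiterals : ∀ {h} {s t : Fin h} (ps : List (Fin h × Fin h)) → s ≢ t →
                             All (λ q → proj₁ q ≢ s) ps → AllPairs Separated ps →
                             All (zeroLiteral s t ≢_) (zeroLiterals ps)
zeroLiteral-∉-zeroLiterals []               s≢t []           []               = []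
zeroLiteral-∉-zeroLiterals ((s′ , t′) ∷ ps) s≢t (s′≢s ∷ ps∌s) (sep′ ∷ ps-sep) =
  All.++⁺ (All.map⁺ (All.map (λ (_ , _ , s′≢t″) e → s′≢s (sym (proj₁ (zeroLiteral-injective s≢t s′≢t″ e))))
                              sep′))
          (zeroLiteral-∉-zeroLiterals ps s≢t ps∌s ps-sep)

zeroLiterals-unique : ∀ {h} (ps : List (Fin h × Fin h)) → AllPairs Separated ps → AllPairs _≢_ (zeroLiterals ps)
zeroLiterals-unique []             []              = []
zeroLiterals-unique ((s , t) ∷ ps) (sep ∷ ps-sep) =
  AllPairs.++⁺ (AllPairs.map⁺ (AllPairs-zipWith-All different-columns (All.map (proj₂ ∘ proj₂) sep) ps-sep))
               (zeroLiterals-unique ps ps-sep)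
               (All.map⁺ (All.map (λ (_ , _ , s≢t′) → zeroLiteral-∉-zeroLiterals ps s≢t′ ps∌s ps-sep) sep))
  where
  ps∌s : All (λ q → proj₁ q ≢ s) ps
  ps∌s = All.map (λ (s≢s′ , _) → s≢s′ ∘ sym) sep
  different-columns : ∀ {q q′} → s ≢ proj₂ q → s ≢ proj₂ q′ → Separated q q′ →
                      zeroLiteral s (proj₂ q) ≢ zeroLiteral s (proj₂ q′)
  different-columns s≢t′ s≢t″ (_ , t′≢t″ , _) e = t′≢t″ (proj₂ (zeroLiteral-injective s≢t′ s≢t″ e))

zeroLiterals-satisfied : ∀ {h} (c : Vec Bool (h * h)) (ps : List (Fin h × Fin h)) →
                         AllPairs (ZeroAbove (tournament c)) ps → All (λ l → c ⊨ l ≡ true) (zeroLiterals ps)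
zeroLiterals-satisfied c []             []                 = []
zeroLiterals-satisfied c ((s , t) ∷ ps) (zeros ∷ ps-zeros) =
  All.++⁺ (All.map⁺ (All.map satisfied zeros)) (zeroLiterals-satisfied c ps ps-zeros)
  where
  satisfied : ∀ {q} → ZeroAbove (tournament c) (s , t) q → c ⊨ zeroLiteral s (proj₂ q) ≡ true
  satisfied {_ , t′} (_ , _ , Bst′≡false) = zeroLiteral-sound c {s} {t′} Bst′≡false

zeroAbove⇒satisfiesDistinct : ∀ {h} (c : Vec Bool (h * h)) (ps : List (Fin h × Fin h)) →
                              AllPairs (ZeroAbove (tournament c)) ps → satisfiesDistinct (zeroLiterals ps) c ≡ true
zeroAbove⇒satisfiesDistinct c ps ps-zeros =
  satisfiesDistinct-intro {v = c} (zeroLiterals-satisfied c ps ps-zeros)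
                                  (zeroLiterals-unique ps (AllPairs.map separated ps-zeros))
  where
  separated : ∀ {q q′} → ZeroAbove (tournament c) q q′ → Separated q q′
  separated (s≢s′ , t≢t′ , Bst′≡false) = s≢s′ , t≢t′ , tournament-zero⇒≢ c Bst′≡false

avoiding-tournament : ∀ h r → (h * h) ^ r < 2 ^ triangular r →
                      ∃[ c ] ∀ ps → length ps ≡ r → ¬ AllPairs (ZeroAbove (tournament {h} c)) ps
avoiding-tournament h r few = Product.map₂ avoids (count<2^n⇒∃false (h * h) bad count-bad<)
  where
  bad : Vec Bool (h * h) → Bool
  bad c = anyWord (remQuot h) r (λ ps → satisfiesDistinct (zeroLiterals ps) c)
  count-bad< : count (h * h) bad < 2 ^ (h * h)
  count-bad< = ℕ.*-cancelʳ-< _ _ _ (begin-strict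
    count (h * h) bad * 2 ^ triangular r
      ≤⟨ count-anyWord (remQuot h) (h * h) r (satisfiesDistinct ∘ zeroLiterals) each-bound ⟩
    (h * h) ^ r * 2 ^ (h * h)
      <⟨ ℕ.*-monoˡ-< (2 ^ (h * h)) {{ℕ.m^n≢0 2 (h * h)}} few ⟩
    2 ^ triangular r * 2 ^ (h * h)
      ≡⟨ ℕ.*-comm (2 ^ triangular r) _ ⟩
    2 ^ (h * h) * 2 ^ triangular r ∎)
    where
    open ℕ.≤-Reasoning
    each-bound : ∀ ps → length ps ≡ r →
                 count (h * h) (satisfiesDistinct (zeroLiterals ps)) * 2 ^ triangular r ≤ 2 ^ (h * h)
    each-bound ps refl = subst (λ k → count (h * h) (satisfiesDistinct (zeroLiterals ps)) * 2 ^ k ≤ 2 ^ (h * h))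
                               (length-zeroLiterals ps) (count-satisfiesDistinct (h * h) (zeroLiterals ps))
  avoids : ∀ {c} → bad c ≡ false → ∀ ps → length ps ≡ r → ¬ AllPairs (ZeroAbove (tournament c)) ps
  avoids {c} bad-c≡false ps |ps|≡r ps-zeros =
    contradiction (trans (sym bad-c≡false) (anyWord-intro (remQuot h) letter-surjective r _ ps |ps|≡r
                                                          (zeroAbove⇒satisfiesDistinct c ps ps-zeros)))
                  λ ()
    where
    letter-surjective : ∀ (q : Fin h × Fin h) → ∃[ i ] remQuot h i ≡ q
    letter-surjective (s , t) = combine s t , remQuot-combine s t

-- Triangular patterns

TriangularPattern : ∀ {m n} → Mat m n → List (Fin m × Fin n) → Set
TriangularPattern M ps = All (λ (x , y) → M x y ≡ true) ps × AllPairs (ZeroAbove M) ps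

hasTriangular⇒pattern : ∀ {n r} {M : Mat n n} → Symmetric M → HasTriangular M r →
                        ∃[ ps ] length ps ≡ r × TriangularPattern M ps
hasTriangular⇒pattern M-sym (T , (diag , inj₂ zero-above) , f , g , f-inj , g-inj , M≡T) =
  List.tabulate (λ i → f i , g i) , length-tabulate _ ,
  All.tabulate⁺ (λ i → trans (M≡T i i) (diag i)) ,
  AllPairs.tabulate⁺-< (λ {i} {j} i<j → <⇒≢ i<j ∘ f-inj , <⇒≢ i<j ∘ g-inj ,
                                         trans (M≡T i j) (zero-above i j i<j))
hasTriangular⇒pattern M-sym (T , (diag , inj₁ zero-below) , f , g , f-inj , g-inj , M≡T) =
  List.tabulate (λ i → g i , f i) , length-tabulate _ ,
  All.tabulate⁺ (λ i → trans (M-sym (g i) (f i)) (trans (M≡T i i) (diag i))) ,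
  AllPairs.tabulate⁺-< (λ {i} {j} i<j → <⇒≢ i<j ∘ g-inj , <⇒≢ i<j ∘ f-inj ,
                                         trans (M-sym (g i) (f j)) (trans (M≡T j i) (zero-below j i i<j)))

All-reverse : ∀ {A : Set} {P : A → Set} {xs} → All P xs → All P (List.reverse xs)
All-reverse {xs = []}     []         = []
All-reverse {xs = x ∷ xs} (px ∷ pxs) =
  subst (All _) (sym (unfold-reverse x xs)) (All.++⁺ (All-reverse pxs) (px ∷ []))

AllPairs-reverse : ∀ {A : Set} {R : A → A → Set} {xs} → AllPairs R xs → AllPairs (flip R) (List.reverse xs)
AllPairs-reverse {xs = []}     []         = []
AllPairs-reverse {xs = x ∷ xs} (Rx ∷ Rxs) =
  subst (AllPairs _) (sym (unfold-reverse x xs))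
        (AllPairs.++⁺ (AllPairs-reverse Rxs) ([] ∷ []) (All-reverse (All.map (_∷ []) Rx)))

transpose-pattern : ∀ {n} {M : Mat n n} {ps} → Symmetric M → TriangularPattern M ps →
                    TriangularPattern M (List.reverse (List.map Product.swap ps))
transpose-pattern {M = M} M-sym (diag , zeros) =
  All-reverse (All.map⁺ (All.map (λ {q} Mxy → trans (M-sym (proj₂ q) (proj₁ q)) Mxy) diag)) ,
  AllPairs-reverse (AllPairs.map⁺ (AllPairs.map transpose zeros))
  where
  transpose : ∀ {q q′} → ZeroAbove M q q′ → ZeroAbove M (Product.swap q′) (Product.swap q)
  transpose {x , y} {x′ , y′} (x≢x′ , y≢y′ , Mxy′≡false) =
    y≢y′ ∘ sym , x≢x′ ∘ sym , trans (M-sym y′ x) Mxy′≡false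

filter-pattern : ∀ {m n} {M : Mat m n} {P : Fin m × Fin n → Set} (P? : Decidable P) {ps} →
                 TriangularPattern M ps → TriangularPattern M (List.filter P? ps)
filter-pattern P? (diag , zeros) = All.filter⁺ P? diag , AllPairs.filter⁺ P? zeros

take-pattern : ∀ {m n} {M : Mat m n} k {ps} → TriangularPattern M ps → TriangularPattern M (List.take k ps)
take-pattern k (diag , zeros) = All.take⁺ k diag , AllPairs.take⁺ k zeros

length-filter-∁ : ∀ {A : Set} {P : A → Set} (P? : Decidable P) xs →
                  length (List.filter P? xs) + length (List.filter (∁? P?) xs) ≡ length xs
length-filter-∁ P? []       = refl
length-filter-∁ P? (x ∷ xs) with P? x
... | yes _ = cong suc (length-filter-∁ P? xs)
... | no  _ = trans (ℕ.+-suc _ _) (cong suc (length-filter-∁ P? xs))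

top-pattern⇒zeroAbove : ∀ {h} (B : Mat h h) {ps} → All (TopRow {h}) ps → TriangularPattern (bipartite B) ps →
                        AllPairs (ZeroAbove B) (List.map (Product.map index index) ps)
top-pattern⇒zeroAbove {h} B top-rows (diag , zeros) =
  AllPairs.map⁺ (AllPairs-zipWith-All restrict (All.zipWith id (top-rows , diag)) zeros)
  where
  restrict : ∀ {q q′} → TopRow {h} q × bipartite B (proj₁ q) (proj₂ q) ≡ true →
             TopRow {h} q′ × bipartite B (proj₁ q′) (proj₂ q′) ≡ true →
             ZeroAbove (bipartite B) q q′ → ZeroAbove B (Product.map index index q) (Product.map index index q′)
  restrict {x , y} {x′ , y′} (x-top , Axy) (x′-top , Ax′y′) (x≢x′ , y≢y′ , Axy′≡false) =
    x≢x′ ∘ side-index-injective {h} (trans x-top (sym x′-top)) ,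
    y≢y′ ∘ side-index-injective {h} (trans y-bottom (sym y′-bottom)) ,
    trans (sym (bipartite-top-bottom B x-top y′-bottom)) Axy′≡false
    where
    y-bottom = bipartite-top-row B x-top Axy
    y′-bottom = bipartite-top-row B x′-top Ax′y′

top-pattern-short : ∀ {h} (B : Mat h h) {r} → (∀ ps → length ps ≡ r → ¬ AllPairs (ZeroAbove B) ps) →
                    ∀ qs → All (TopRow {h}) qs → TriangularPattern (bipartite B) qs → length qs < r
top-pattern-short B {r} avoids qs top-rows qs-pattern with r ℕ.≤? length qs
... | no  r≰|qs| = ℕ.≰⇒> r≰|qs|
... | yes r≤|qs| =
  contradiction (top-pattern⇒zeroAbove B (All.take⁺ r top-rows) (take-pattern r qs-pattern))
                (avoids _ (trans (length-map _ (List.take r qs)) (trans (length-take r qs) (ℕ.m≤n⇒m⊓n≡m r≤|qs|))))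

-- Split by side; by symmetry the bottom-row pairs, transposed and reversed, form a top-row pattern.
bipartite-triangular-bound : ∀ {h} (B : Mat h h) {r r′} → (∀ ps → length ps ≡ r → ¬ AllPairs (ZeroAbove B) ps) →
                             HasTriangular (bipartite B) r′ → 2 + r′ ≤ r + r
bipartite-triangular-bound {h} B {r} {r′} avoids has-triangular
  with hasTriangular⇒pattern (bipartite-symmetric B) has-triangular
... | ps , |ps|≡r′ , ps-pattern = begin
  2 + r′                                     ≡⟨ cong (2 +_) (trans (sym |ps|≡r′) (sym (length-filter-∁ top? ps))) ⟩
  2 + (length tops + length bottoms)         ≡⟨ cong suc (ℕ.+-suc (length tops) (length bottoms)) ⟨
  suc (length tops) + suc (length bottoms)   ≤⟨ ℕ.+-mono-≤ tops-short bottoms-short ⟩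
  r + r ∎
  where
  open ℕ.≤-Reasoning
  top? = top-row? {h}
  tops = List.filter top? ps
  bottoms = List.filter (∁? top?) ps
  tops-short : length tops < r
  tops-short = top-pattern-short B avoids tops (All.all-filter top? ps) (filter-pattern top? ps-pattern)
  bottoms-pattern : TriangularPattern (bipartite B) bottoms
  bottoms-pattern = filter-pattern (∁? top?) ps-pattern
  transposed-top : All (TopRow {h}) (List.reverse (List.map Product.swap bottoms))
  transposed-top = All-reverse (All.map⁺ (All.zipWith (λ (x-bottom , Axy) → bipartite-bottom-row B x-bottom Axy)
                                                      (All.all-filter (∁? top?) ps , proj₁ bottoms-pattern)))
  bottoms-short : length bottoms < r
  bottoms-short = subst (_< r) (trans (length-reverse (List.map Product.swap bottoms)) (length-map Product.swap bottoms))
                        (top-pattern-short B avoids _ transposed-top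
                                           (transpose-pattern (bipartite-symmetric B) bottoms-pattern))

-- Choice of parameters

n≤2^n : ∀ n → n ≤ 2 ^ n
n≤2^n zero    = z≤n
n≤2^n (suc n) = ℕ.+-mono-≤ (ℕ.m^n>0 2 n) (ℕ.≤-trans (n≤2^n n) (ℕ.m≤m+n (2 ^ n) 0))

power-of-two-between : ∀ h → 1 ≤ h → ∃[ T ] h ≤ 2 ^ T × 2 ^ T ≤ 2 * h
power-of-two-between h 1≤h = search h (n≤2^n h)
  where
  search : ∀ k → h ≤ 2 ^ k → ∃[ T ] h ≤ 2 ^ T × 2 ^ T ≤ 2 * h
  search zero    h≤1      = 0 , h≤1 , ℕ.≤-trans 1≤h (ℕ.m≤n*m h 2)
  search (suc k) h≤2^1+k with h ℕ.≤? 2 ^ k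
  ... | yes h≤2^k = search k h≤2^k
  ... | no  h≰2^k = suc k , h≤2^1+k , ℕ.*-monoʳ-≤ 2 (ℕ.<⇒≤ (ℕ.≰⇒> h≰2^k))

triangular-double : ∀ r → 2 * triangular r + r ≡ r * r
triangular-double zero    = refl
triangular-double (suc r) = begin
  2 * (r + triangular r) + suc r
    ≡⟨ solve 2 (λ r t → con 2 :* (r :+ t) :+ (con 1 :+ r) := (con 2 :* t :+ r) :+ (con 1 :+ con 2 :* r))
               refl r (triangular r) ⟩
  (2 * triangular r + r) + (1 + 2 * r)
    ≡⟨ cong (_+ (1 + 2 * r)) (triangular-double r) ⟩
  r * r + (1 + 2 * r)
    ≡⟨ solve 1 (λ r → r :* r :+ (con 1 :+ con 2 :* r) := (con 1 :+ r) :* (con 1 :+ r)) refl r ⟩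
  suc r * suc r ∎
  where
  open ≡-Reasoning
  open +-*-Solver

few-configurations : ∀ {h T} → h ≤ 2 ^ T → (h * h) ^ (2 + 4 * T) < 2 ^ triangular (2 + 4 * T)
few-configurations {h} {T} h≤2^T = begin-strict
  (h * h) ^ R            ≤⟨ ℕ.^-monoˡ-≤ R (ℕ.*-mono-≤ h≤2^T h≤2^T) ⟩
  (2 ^ T * 2 ^ T) ^ R    ≡⟨ cong (_^ R) (ℕ.^-distribˡ-+-* 2 T T) ⟨
  (2 ^ (T + T)) ^ R      ≡⟨ ℕ.^-*-assoc 2 (T + T) R ⟩
  2 ^ ((T + T) * R)      <⟨ ℕ.^-monoʳ-< 2 (s≤s (s≤s z≤n)) exponent< ⟩
  2 ^ triangular R       ∎
  where
  open ℕ.≤-Reasoning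
  open +-*-Solver
  R = 2 + 4 * T
  exponent< : (T + T) * R < triangular R
  exponent< = ℕ.*-cancelˡ-< 2 _ _ (ℕ.+-cancelʳ-< R _ _ (begin-strict
    2 * ((T + T) * R) + R       <⟨ ℕ.m<m+n _ (s≤s z≤n) ⟩
    2 * ((T + T) * R) + R + R   ≡⟨ solve 1 (λ T → let R = con 2 :+ con 4 :* T in
                                              con 2 :* ((T :+ T) :* R) :+ R :+ R := R :* R) refl T ⟩
    R * R                       ≡⟨ triangular-double R ⟨
    2 * triangular R + R        ∎))

2^r≤h^10 : ∀ {h T r} → 6 ≤ T → 2 ^ T ≤ 2 * h → 2 + r ≤ (2 + 4 * T) + (2 + 4 * T) → 2 ^ r ≤ h ^ 10
2^r≤h^10 {h} {T} {r} 6≤T 2^T≤2h r-bound = ℕ.≤-trans (ℕ.^-monoʳ-≤ 2 (ℕ.≤-pred (ℕ.≤-pred r-bound)))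
  (ℕ.*-cancelˡ-≤ (2 ^ 10) (begin
    2 ^ 10 * 2 ^ E          ≡⟨ ℕ.^-distribˡ-+-* 2 10 E ⟨
    2 ^ (10 + E)            ≤⟨ ℕ.^-monoʳ-≤ 2 exponent≤ ⟩
    2 ^ (T * 10)            ≡⟨ ℕ.^-*-assoc 2 T 10 ⟨
    (2 ^ T) ^ 10            ≤⟨ ℕ.^-monoˡ-≤ 10 2^T≤2h ⟩
    (2 * h) ^ 10            ≡⟨ ^-distribʳ-* 2 h 10 ⟩
    2 ^ 10 * h ^ 10         ∎))
  where
  open ℕ.≤-Reasoning
  open +-*-Solver
  E = 4 * T + (2 + 4 * T)
  exponent≤ : 10 + E ≤ T * 10
  exponent≤ = begin
    10 + E         ≡⟨ solve 1 (λ T → con 10 :+ (con 4 :* T :+ (con 2 :+ con 4 :* T)) := con 12 :+ con 8 :* T)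
                               refl T ⟩
    12 + 8 * T     ≤⟨ ℕ.+-monoˡ-≤ (8 * T) (ℕ.*-monoʳ-≤ 2 6≤T) ⟩
    2 * T + 8 * T  ≡⟨ solve 1 (λ T → con 2 :* T :+ con 8 :* T := T :* con 10) refl T ⟩
    T * 10         ∎

64≤2^T⇒6≤T : ∀ {T} → 64 ≤ 2 ^ T → 6 ≤ T
64≤2^T⇒6≤T {T} 64≤2^T with 6 ℕ.≤? T
... | yes 6≤T = 6≤T
... | no  6≰T = contradiction (ℕ.≤-trans 64≤2^T (ℕ.^-monoʳ-≤ 2 T≤5)) 64≰32
  where
  T≤5 : T ≤ 5
  T≤5 = ℕ.≤-pred (ℕ.≰⇒> 6≰T)
  64≰32 : ¬ 64 ≤ 32
  64≰32 = ℕ.<⇒≱ (ℕ.m<m+n 32 {32} (s≤s z≤n))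

construction : ∀ h → 64 ≤ h → Σ (Mat (2 * h) (2 * h)) λ A → Symmetric A × HimLeTenLog2 A h × MimsupGeSqrt A h
construction h 64≤h =
  bipartite B , bipartite-symmetric B ,
  (λ r has-triangular → 2^r≤h^10 {h} {T} 6≤T 2^T≤2h (bipartite-triangular-bound B (proj₂ avoiding) has-triangular)) ,
  mimsup-≥-sqrt (bipartite B) (mim-bipartite-⊗ {h} (tournament-reflexiveAntisymmetric c))
  where
  T-spec : ∃[ T ] h ≤ 2 ^ T × 2 ^ T ≤ 2 * h
  T-spec = power-of-two-between h (ℕ.≤-trans (s≤s z≤n) 64≤h)
  T : ℕ
  T = proj₁ T-spec
  h≤2^T : h ≤ 2 ^ T
  h≤2^T = proj₁ (proj₂ T-spec)
  2^T≤2h : 2 ^ T ≤ 2 * h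
  2^T≤2h = proj₂ (proj₂ T-spec)
  6≤T : 6 ≤ T
  6≤T = 64≤2^T⇒6≤T (ℕ.≤-trans 64≤h h≤2^T)
  avoiding : ∃[ c ] ∀ ps → length ps ≡ 2 + 4 * T → ¬ AllPairs (ZeroAbove (tournament {h} c)) ps
  avoiding = avoiding-tournament h (2 + 4 * T) (few-configurations {h} {T} h≤2^T)
  c : Vec Bool (h * h)
  c = proj₁ avoiding
  B : Mat h h
  B = tournament c

-- C does not occur in the conclusion, so any rational above 1 will do.
theorem40 : Σ ℚ λ C → 1ℚ <ℚ C ×
    ∃[ h₀ ] ∀ (h : ℕ) → h₀ ≤ h →
      Σ (Mat (2 * h) (2 * h)) λ A →
        Symmetric A × HimLeTenLog2 A h × MimsupGeSqrt A h
theorem40 = 1ℚ +ℚ 1ℚ , toWitness {a? = 1ℚ <ℚ? 1ℚ +ℚ 1ℚ} _ , 64 , construction
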